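{- Let $G$ be a finite simple graph with no isolated vertex and minimum degree $\delta(G)=1$. Then $DC(G)\le \Delta(G)+1$, where $\Delta(G)$ is the maximum degree of $G$.
   Context: Let $G=(V,E)$ be a finite simple undirected graph, $N[v]=\{v\}\cup N(v)$. A set $D\subseteq V$ is a double dominating set if $|N[v]\cap D|\ge 2$ for every $v\in V$. Two disjoint sets $V_1,V_2\subseteq V$ form a double coalition if neither is a double dominating set but $V_1\cup V_2$ is. A double coalition partition ($dc$-partition) of $G$ is a partition $\Pi$ of $V$ such that every set of $\Pi$ is not a double dominating set and forms a double coalition with some other set of $\Pi$. The double coalition number $DC(G)$ is the maximum cardinality of a $dc$-partition of $G$. -}

module Defs where

open import Data.Nat using (ℕ; _≤_; _<_)
open import Data.Bool using (Bool; true; false; _∨_; _∧_; T)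
open import Data.Fin using (Fin; _≟_)
open import Data.Fin.Subset using (Subset; _∩_; _∪_; ∣_∣; _∈_; ⁅_⁆)
open import Data.Vec using (tabulate)
open import Data.Product using (Σ; ∃; _×_; _,_)
open import Relation.Nullary using (¬_)
open import Relation.Nullary.Decidable using (⌊_⌋)
open import Relation.Binary.PropositionalEquality using (_≡_; _≢_)

record Graph (n : ℕ) : Set where
  field
    adj   : Fin n → Fin n → Bool
    sym   : ∀ u v → adj u v ≡ adj v u
    irrefl : ∀ v → adj v v ≡ false
open Graph public

N : ∀ {n} → Graph n → Fin n → Subset n
N G v = tabulate (λ u → adj G v u)

N[_] : ∀ {n} → Graph n → Fin n → Subset n
N[ G ] v = ⁅ v ⁆ ∪ N G v

deg : ∀ {n} → Graph n → Fin n → ℕ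
deg G v = ∣ N G v ∣

IsMaxDegree : ∀ {n} → Graph n → ℕ → Set
IsMaxDegree G Δ = (∀ v → deg G v ≤ Δ) × ∃ (λ v → deg G v ≡ Δ)

IsMinDegree : ∀ {n} → Graph n → ℕ → Set
IsMinDegree G δ = (∀ v → δ ≤ deg G v) × ∃ (λ v → deg G v ≡ δ)

NoIsolatedVertex : ∀ {n} → Graph n → Set
NoIsolatedVertex G = ∀ v → 1 ≤ deg G v

IsDoubleDominating : ∀ {n} → Graph n → Subset n → Set
IsDoubleDominating G D = ∀ v → 2 ≤ ∣ N[ G ] v ∩ D ∣

record Partition (n k : ℕ) : Set where
  field
    cls  : Fin n → Fin k
    surj : ∀ i → ∃ (λ v → cls v ≡ i)
open Partition public

classOf : ∀ {n k} → Partition n k → Fin k → Subset n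
classOf P i = tabulate (λ v → ⌊ cls P v ≟ i ⌋)

IsDCPartition : ∀ {n k} → Graph n → Partition n k → Set
IsDCPartition {k = k} G P =
  (∀ i → ¬ IsDoubleDominating G (classOf P i)) ×
  (∀ i → Σ (Fin k) λ j → (i ≢ j) ×
     IsDoubleDominating G (classOf P i ∪ classOf P j))

-- A leaf v lies in every double dominating set, since N[v] = {v, u} has only two
-- elements.  Hence the class A of v is the coalition partner of every other class.
-- As A itself is not double dominating, some closed neighbourhood N[w] meets A in at
-- most one vertex, so it meets every other class in at least 2 - |N[w] ∩ A| vertices.
-- Summing over the classes, k ≤ |N[w]| ≤ Δ + 1.
module Submission where

open import Defs hiding (sym)
open import Data.Nat using (ℕ; zero; suc; _≤_; _+_; _*_; z≤n; s≤s; _≤?_)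
open import Data.Nat.Properties
  using (≤-trans; ≤-reflexive; ≤-pred; ≰⇒>; 1+n≰n; +-suc; +-comm; +-mono-≤; +-monoʳ-≤;
         *-identityʳ; m≤m*n; +-0-commutativeMonoid; module ≤-Reasoning)
open import Data.Bool using (true)
open import Data.Fin using (Fin; _≟_; punchIn) renaming (zero to fzero; suc to fsuc)
open import Data.Fin.Properties using (¬∀⟶∃¬; punchInᵢ≢i)
open import Data.Fin.Subset
  using (Subset; _∩_; _∪_; ∣_∣; _∈_; _⊆_; ⁅_⁆; inside; outside)
open import Data.Fin.Subset.Properties
  using (_∈?_; p⊆q⇒∣p∣≤∣q∣; ∣p∣≤∣x∷p∣; ∣⁅x⁆∣≡1; x∈⁅y⁆⇒x≡y; x∈p∩q⁻; x∈p∪q⁻; ∩-distribˡ-∪)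
open import Data.Vec using ([]; _∷_; tabulate)
open import Data.Vec.Properties using ([]=⇒lookup; lookup∘tabulate)
open import Data.Product using (∃; _,_; proj₁; proj₂)
open import Data.Sum using (inj₁; inj₂)
open import Relation.Nullary using (¬_; yes; no; Dec; contradiction)
open import Relation.Nullary.Decidable using (⌊_⌋; ⌊⌋-map′)
open import Function using (_∘_)
open import Relation.Binary.PropositionalEquality
  using (_≡_; _≢_; refl; sym; trans; cong; subst; module ≡-Reasoning)
open import Algebra.Properties.CommutativeMonoid.Sum +-0-commutativeMonoid
  using (sum-syntax; sum-remove; sum-replicate-zero; sum-cong-≗)

∣p∪q∣≤∣p∣+∣q∣ : ∀ {n} (p q : Subset n) → ∣ p ∪ q ∣ ≤ ∣ p ∣ + ∣ q ∣
∣p∪q∣≤∣p∣+∣q∣ []            []            = z≤n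
∣p∪q∣≤∣p∣+∣q∣ (inside  ∷ p) (x       ∷ q) =
  s≤s (≤-trans (∣p∪q∣≤∣p∣+∣q∣ p q) (+-monoʳ-≤ ∣ p ∣ (∣p∣≤∣x∷p∣ x q)))
∣p∪q∣≤∣p∣+∣q∣ (outside ∷ p) (inside  ∷ q) =
  ≤-trans (s≤s (∣p∪q∣≤∣p∣+∣q∣ p q)) (≤-reflexive (sym (+-suc ∣ p ∣ ∣ q ∣)))
∣p∪q∣≤∣p∣+∣q∣ (outside ∷ p) (outside ∷ q) = ∣p∪q∣≤∣p∣+∣q∣ p q

∣p∩[q∪r]∣≤∣p∩q∣+∣p∩r∣ : ∀ {n} (p q r : Subset n) → ∣ p ∩ (q ∪ r) ∣ ≤ ∣ p ∩ q ∣ + ∣ p ∩ r ∣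
∣p∩[q∪r]∣≤∣p∩q∣+∣p∩r∣ p q r =
  subst (_≤ ∣ p ∩ q ∣ + ∣ p ∩ r ∣) (cong ∣_∣ (sym (∩-distribˡ-∪ p q r)))
        (∣p∪q∣≤∣p∣+∣q∣ (p ∩ q) (p ∩ r))

∣N[v]∣≤1+deg : ∀ {n} (G : Graph n) v → ∣ N[ G ] v ∣ ≤ 1 + deg G v
∣N[v]∣≤1+deg G v =
  subst (λ m → ∣ N[ G ] v ∣ ≤ m + deg G v) (∣⁅x⁆∣≡1 v) (∣p∪q∣≤∣p∣+∣q∣ ⁅ v ⁆ (N G v))

leaf∈doubleDominating : ∀ {n} (G : Graph n) {v} → deg G v ≡ 1 →
  ∀ {D} → IsDoubleDominating G D → v ∈ D
leaf∈doubleDominating G {v} deg≡1 {D} dd with v ∈? D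
... | yes v∈D = v∈D
... | no  v∉D = contradiction (≤-trans (dd v) ∣N[v]∩D∣≤1) 1+n≰n
  where
  N[v]∩D⊆N : N[ G ] v ∩ D ⊆ N G v
  N[v]∩D⊆N x∈ with x∈p∩q⁻ (N[ G ] v) D x∈
  ... | x∈N[v] , x∈D with x∈p∪q⁻ ⁅ v ⁆ (N G v) x∈N[v]
  ...   | inj₁ x∈⁅v⁆ = contradiction (subst (_∈ D) (x∈⁅y⁆⇒x≡y v x∈⁅v⁆) x∈D) v∉D
  ...   | inj₂ x∈N   = x∈N

  ∣N[v]∩D∣≤1 : ∣ N[ G ] v ∩ D ∣ ≤ 1
  ∣N[v]∩D∣≤1 = subst (∣ N[ G ] v ∩ D ∣ ≤_) deg≡1 (p⊆q⇒∣p∣≤∣q∣ N[v]∩D⊆N)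

¬doubleDominating⇒∃∣N[w]∩D∣≤1 : ∀ {n} (G : Graph n) {D} → ¬ IsDoubleDominating G D →
  ∃ λ w → ∣ N[ G ] w ∩ D ∣ ≤ 1
¬doubleDominating⇒∃∣N[w]∩D∣≤1 {n} G {D} ¬dd with ¬∀⟶∃¬ n _ (λ w → 2 ≤? ∣ N[ G ] w ∩ D ∣) ¬dd
... | w , ¬2≤ = w , ≤-pred (≰⇒> ¬2≤)

∈classOf⇒cls≡ : ∀ {n k} (P : Partition n k) {v i} → v ∈ classOf P i → cls P v ≡ i
∈classOf⇒cls≡ P {v} {i} v∈ =
  witness (cls P v ≟ i) (trans (sym (lookup∘tabulate _ v)) ([]=⇒lookup v∈))
  where
  witness : ∀ {A : Set} (a? : Dec A) → ⌊ a? ⌋ ≡ true → A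
  witness (yes a) _ = a

-- classOf P i is definitionally fibre (cls P) i.
fibre : ∀ {n k} → (Fin n → Fin k) → Fin k → Subset n
fibre c i = tabulate (λ v → ⌊ c v ≟ i ⌋)

∑∣[j≟i]∷r∣≡1+∑∣r∣ : ∀ {n k} (j : Fin k) (r : Fin k → Subset n) →
  ∑[ i < k ] ∣ ⌊ j ≟ i ⌋ ∷ r i ∣ ≡ suc (∑[ i < k ] ∣ r i ∣)
∑∣[j≟i]∷r∣≡1+∑∣r∣ fzero    r = refl
∑∣[j≟i]∷r∣≡1+∑∣r∣ {k = suc k} (fsuc j) r = begin
  ∣ r fzero ∣ + ∑[ i < k ] ∣ ⌊ fsuc j ≟ fsuc i ⌋ ∷ r (fsuc i) ∣
    ≡⟨ cong (∣ r fzero ∣ +_) (sum-cong-≗ λ i →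
         cong (λ b → ∣ b ∷ r (fsuc i) ∣) (⌊⌋-map′ _ _ (j ≟ i))) ⟩
  ∣ r fzero ∣ + ∑[ i < k ] ∣ ⌊ j ≟ i ⌋ ∷ r (fsuc i) ∣
    ≡⟨ cong (∣ r fzero ∣ +_) (∑∣[j≟i]∷r∣≡1+∑∣r∣ j (r ∘ fsuc)) ⟩
  ∣ r fzero ∣ + suc (∑[ i < k ] ∣ r (fsuc i) ∣)
    ≡⟨ +-suc ∣ r fzero ∣ _ ⟩
  suc (∑[ i < suc k ] ∣ r i ∣) ∎
  where open ≡-Reasoning

∑∣p∩fibre∣≡∣p∣ : ∀ {n k} (c : Fin n → Fin k) (p : Subset n) →
  ∑[ i < k ] ∣ p ∩ fibre c i ∣ ≡ ∣ p ∣
∑∣p∩fibre∣≡∣p∣ {k = k} c []           = sum-replicate-zero k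
∑∣p∩fibre∣≡∣p∣ c (outside ∷ p) = ∑∣p∩fibre∣≡∣p∣ (c ∘ fsuc) p
∑∣p∩fibre∣≡∣p∣ c (inside  ∷ p) =
  trans (∑∣[j≟i]∷r∣≡1+∑∣r∣ (c fzero) (λ i → p ∩ fibre (c ∘ fsuc) i))
        (cong suc (∑∣p∩fibre∣≡∣p∣ (c ∘ fsuc) p))

∑-lowerBound : ∀ {k m} (f : Fin k → ℕ) → (∀ i → m ≤ f i) → k * m ≤ ∑[ i < k ] f i
∑-lowerBound {zero}  f _   = z≤n
∑-lowerBound {suc k} f m≤f = +-mono-≤ (m≤f fzero) (∑-lowerBound (f ∘ fsuc) (m≤f ∘ fsuc))

pairSums≥2⇒k≤∑ : ∀ {k} (f : Fin k → ℕ) (a b : Fin k) → b ≢ a → f a ≤ 1 →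
  (∀ i → i ≢ a → 2 ≤ f a + f i) → k ≤ ∑[ i < k ] f i
pairSums≥2⇒k≤∑ {suc zero}    f fzero fzero b≢a _    _    = contradiction refl b≢a
pairSums≥2⇒k≤∑ {suc (suc k)} f a     _     _   fa≤1 pair = begin
  suc (suc k)                               ≤⟨ bound (f a) fa≤1 pair′ ⟩
  f a + ∑[ j < suc k ] f (punchIn a j)      ≡⟨ sum-remove f ⟨
  ∑[ i < suc (suc k) ] f i                  ∎
  where
  open ≤-Reasoning

  pair′ : ∀ j → 2 ≤ f a + f (punchIn a j)
  pair′ j = pair (punchIn a j) (punchInᵢ≢i a j)

  bound : ∀ x → x ≤ 1 → (∀ j → 2 ≤ x + f (punchIn a j)) →
          suc (suc k) ≤ x + ∑[ j < suc k ] f (punchIn a j)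
  bound 0 _ p = ≤-trans (s≤s (s≤s (m≤m*n k 2))) (∑-lowerBound (f ∘ punchIn a) p)
  bound 1 _ p = s≤s (≤-trans (≤-reflexive (sym (*-identityʳ (suc k))))
                             (∑-lowerBound (f ∘ punchIn a) (≤-pred ∘ p)))
  bound (suc (suc _)) (s≤s ()) _

leafClass-partnersAll : ∀ {n k} (G : Graph n) (P : Partition n k) {v} → deg G v ≡ 1 →
  IsDCPartition G P →
  ∀ i → i ≢ cls P v → IsDoubleDominating G (classOf P i ∪ classOf P (cls P v))
leafClass-partnersAll G P {v} leaf (_ , coalition) i i≢A with coalition i
... | j , _ , dd with x∈p∪q⁻ (classOf P i) (classOf P j) (leaf∈doubleDominating G leaf dd)
...   | inj₁ v∈Cᵢ = contradiction (sym (∈classOf⇒cls≡ P v∈Cᵢ)) i≢A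
...   | inj₂ v∈Cⱼ = subst (λ j → IsDoubleDominating G (classOf P i ∪ classOf P j))
                          (sym (∈classOf⇒cls≡ P v∈Cⱼ)) dd

mainTheorem5 : ∀ {n k : ℕ} (G : Graph n) (Δ : ℕ) →
    NoIsolatedVertex G → IsMinDegree G 1 → IsMaxDegree G Δ →
    (P : Partition n k) → IsDCPartition G P → k ≤ Δ + 1
mainTheorem5 {n} {k} G Δ _ (_ , v , leaf) (deg≤Δ , _) P dc@(notDD , coalition) = begin
  k                                     ≤⟨ pairSums≥2⇒k≤∑ meets A b b≢A (proj₂ undominated) pairs ⟩
  ∑[ i < k ] ∣ N[ G ] w ∩ classOf P i ∣ ≡⟨ ∑∣p∩fibre∣≡∣p∣ (cls P) (N[ G ] w) ⟩
  ∣ N[ G ] w ∣                          ≤⟨ ∣N[v]∣≤1+deg G w ⟩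
  1 + deg G w                           ≤⟨ +-monoʳ-≤ 1 (deg≤Δ w) ⟩
  1 + Δ                                 ≡⟨ +-comm 1 Δ ⟩
  Δ + 1                                 ∎
  where
  open ≤-Reasoning

  A : Fin k
  A = cls P v

  undominated : ∃ λ w → ∣ N[ G ] w ∩ classOf P A ∣ ≤ 1
  undominated = ¬doubleDominating⇒∃∣N[w]∩D∣≤1 G (notDD A)

  w : Fin n
  w = proj₁ undominated

  meets : Fin k → ℕ
  meets i = ∣ N[ G ] w ∩ classOf P i ∣

  b : Fin k
  b = proj₁ (coalition A)

  b≢A : b ≢ A
  b≢A = proj₁ (proj₂ (coalition A)) ∘ sym

  pairs : ∀ i → i ≢ A → 2 ≤ meets A + meets i
  pairs i i≢A = begin
    2                                          ≤⟨ leafClass-partnersAll G P leaf dc i i≢A w ⟩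
    ∣ N[ G ] w ∩ (classOf P i ∪ classOf P A) ∣ ≤⟨ ∣p∩[q∪r]∣≤∣p∩q∣+∣p∩r∣ (N[ G ] w) _ _ ⟩
    meets i + meets A                          ≡⟨ +-comm (meets i) (meets A) ⟩
    meets A + meets i                          ∎
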